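{- Let $A$ be a finite non-empty set of agents. For all distinct agents $a,b\in A$ and every formula $\varphi\in\mathcal{L}_{KS}$, $\vdash_{\mathsf{SSL}}S_a\varphi\to\neg K_bS_a\varphi$ and $\vdash_{\mathsf{SSL}}S_a\varphi\to\neg K_b\neg S_a\varphi$.
   Context: The language $\mathcal{L}_{KS}$ over a countable set $\mathsf{Prop}$ of variables and agents $A$ is $\varphi::=p\mid\neg\varphi\mid(\varphi\wedge\varphi)\mid K_a\varphi\mid S_a\varphi$. The system $\mathsf{SSL}$ has axioms: all propositional tautologies; for each $a\in A$: (K) $K_a(\varphi\to\psi)\to(K_a\varphi\to K_a\psi)$, (T) $K_a\varphi\to\varphi$, (4) $K_a\varphi\to K_aK_a\varphi$, (5) $\neg K_a\varphi\to K_a\neg K_a\varphi$, (S1) $S_a\varphi\to K_a\varphi$, (S4) $S_a\varphi\to K_aS_a\varphi$; and for distinct $a,b\in A$: (S2) $S_a\varphi\to\neg K_b\varphi$. Rules: modus ponens; from $\varphi$ infer $K_a\varphi$; from $\vdash\varphi\leftrightarrow\psi$ infer $\vdash S_a\varphi\leftrightarrow S_a\psi$. -}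

module Defs where

open import Data.Nat using (ℕ)
open import Data.Fin using (Fin)
open import Data.Bool using (Bool; true; false; not; _∧_)
open import Relation.Binary.PropositionalEquality using (_≡_)
open import Relation.Nullary using (¬_)

data Form (Ag : Set) : Set where
  var  : ℕ → Form Ag
  ¬'_  : Form Ag → Form Ag
  _∧'_ : Form Ag → Form Ag → Form Ag
  K    : Ag → Form Ag → Form Ag
  S    : Ag → Form Ag → Form Ag

infix 30 ¬'_
infixr 25 _∧'_

module _ {Ag : Set} where
  infixr 20 _→'_
  infix 15 _↔'_
  _→'_ : Form Ag → Form Ag → Form Ag
  φ →' ψ = ¬' (φ ∧' ¬' ψ)

  _↔'_ : Form Ag → Form Ag → Form Ag
  φ ↔' ψ = (φ →' ψ) ∧' (ψ →' φ)

  -- Boolean evaluation where propositional variables and modal formulas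
  -- (K_a ψ, S_a ψ) are treated as propositional atoms, valued by v.
  ⟦_⟧ : Form Ag → (Form Ag → Bool) → Bool
  ⟦ var p ⟧ v = v (var p)
  ⟦ ¬' φ ⟧ v = not (⟦ φ ⟧ v)
  ⟦ φ ∧' ψ ⟧ v = ⟦ φ ⟧ v ∧ ⟦ ψ ⟧ v
  ⟦ K a φ ⟧ v = v (K a φ)
  ⟦ S a φ ⟧ v = v (S a φ)

  Tautology : Form Ag → Set
  Tautology φ = (v : Form Ag → Bool) → ⟦ φ ⟧ v ≡ true

data ⊢SSL {Ag : Set} : Form Ag → Set where
  taut : ∀ {φ} → Tautology φ → ⊢SSL φ
  axK  : ∀ a φ ψ → ⊢SSL (K a (φ →' ψ) →' (K a φ →' K a ψ))
  axT  : ∀ a φ → ⊢SSL (K a φ →' φ)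
  ax4  : ∀ a φ → ⊢SSL (K a φ →' K a (K a φ))
  ax5  : ∀ a φ → ⊢SSL (¬' K a φ →' K a (¬' K a φ))
  axS1 : ∀ a φ → ⊢SSL (S a φ →' K a φ)
  axS4 : ∀ a φ → ⊢SSL (S a φ →' K a (S a φ))
  axS2 : ∀ a b φ → ¬ (a ≡ b) → ⊢SSL (S a φ →' ¬' K b φ)
  mp   : ∀ {φ ψ} → ⊢SSL (φ →' ψ) → ⊢SSL φ → ⊢SSL ψ
  nec  : ∀ a {φ} → ⊢SSL φ → ⊢SSL (K a φ)
  reS  : ∀ a {φ ψ} → ⊢SSL (φ ↔' ψ) → ⊢SSL (S a φ ↔' S a ψ)

-- Part one: S_a φ gives K_a φ and hence φ, so by necessitation and K, K_b S_a φ
-- would give K_b φ, which S2 rules out. Part two is axiom T for b: K_b ¬S_a φ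
-- would give ¬S_a φ.
module Submission where

open import Defs
open import Data.Nat using (ℕ; suc)
open import Data.Fin using (Fin)
open import Data.Bool using (true; false)
open import Data.Product using (_×_; _,_)
open import Relation.Binary.PropositionalEquality using (_≡_; refl)
open import Relation.Nullary using (¬_)

module _ {Ag : Set} where

  →-trans : ∀ {φ ψ χ : Form Ag} → ⊢SSL (φ →' ψ) → ⊢SSL (ψ →' χ) → ⊢SSL (φ →' χ)
  →-trans {φ} {ψ} {χ} φ→ψ ψ→χ = mp (mp (taut tautology) φ→ψ) ψ→χ
    where
    tautology : Tautology ((φ →' ψ) →' (ψ →' χ) →' (φ →' χ))
    tautology v with ⟦ φ ⟧ v | ⟦ ψ ⟧ v | ⟦ χ ⟧ v
    ... | true  | true  | true  = refl
    ... | true  | true  | false = refl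
    ... | true  | false | true  = refl
    ... | true  | false | false = refl
    ... | false | true  | true  = refl
    ... | false | true  | false = refl
    ... | false | false | true  = refl
    ... | false | false | false = refl

  contraposition : ∀ {φ ψ : Form Ag} → ⊢SSL (ψ →' ¬' φ) → ⊢SSL (φ →' ¬' ψ)
  contraposition {φ} {ψ} ψ→¬φ = mp (taut tautology) ψ→¬φ
    where
    tautology : Tautology ((ψ →' ¬' φ) →' (φ →' ¬' ψ))
    tautology v with ⟦ φ ⟧ v | ⟦ ψ ⟧ v
    ... | true  | true  = refl
    ... | true  | false = refl
    ... | false | true  = refl
    ... | false | false = refl

  →-¬-weaken : ∀ {φ ψ χ : Form Ag} → ⊢SSL (φ →' ¬' χ) → ⊢SSL (ψ →' χ) → ⊢SSL (φ →' ¬' ψ)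
  →-¬-weaken φ→¬χ ψ→χ = contraposition (→-trans ψ→χ (contraposition φ→¬χ))

  K-mono : ∀ a {φ ψ : Form Ag} → ⊢SSL (φ →' ψ) → ⊢SSL (K a φ →' K a ψ)
  K-mono a {φ} {ψ} φ→ψ = mp (axK a φ ψ) (nec a φ→ψ)

  S⇒ : ∀ a (φ : Form Ag) → ⊢SSL (S a φ →' φ)
  S⇒ a φ = →-trans (axS1 a φ) (axT a φ)

  S⇒¬KS : ∀ {a b} → ¬ (a ≡ b) → (φ : Form Ag) → ⊢SSL (S a φ →' ¬' K b (S a φ))
  S⇒¬KS {a} {b} a≢b φ = →-¬-weaken (axS2 a b φ a≢b) (K-mono b (S⇒ a φ))

  S⇒¬K¬S : ∀ a b (φ : Form Ag) → ⊢SSL (S a φ →' ¬' K b (¬' S a φ))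
  S⇒¬K¬S a b φ = contraposition (axT b (¬' S a φ))

proposition4p7 : (n : ℕ) (a b : Fin (suc n)) → ¬ (a ≡ b) → (φ : Form (Fin (suc n)))
    → ⊢SSL (S a φ →' ¬' K b (S a φ)) × ⊢SSL (S a φ →' ¬' K b (¬' S a φ))
proposition4p7 n a b a≢b φ = S⇒¬KS a≢b φ , S⇒¬K¬S a b φ
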